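{- Let $dWHA$ be the Hopf algebra of substitutions described in the context, and define a bilinear form on $dWHA$ by $\left\langle \binom{\rho}{\sigma},\binom{\rho'}{\sigma'}\right\rangle=1$ if there is a renaming of variables (representing both substitutions with $\mathrm{supp}(\rho)=\mathrm{supp}(\sigma)=\mathrm{supp}(\rho')=\mathrm{supp}(\sigma')$) such that $\rho=\sigma'$ and $\rho'=\sigma$, and $0$ otherwise. Then $dWHA$ is selfdual with respect to this inner product, i.e. for all substitutions $p,p',q$ one has $\langle m(p\otimes p'),q\rangle=\langle p\otimes p',\mu(q)\rangle$, where on the right $\langle a\otimes b,c\otimes d\rangle=\langle a,c\rangle\langle b,d\rangle$.
   Context: Fix an infinite auxiliary alphabet $\mathcal{X}=\{x_1,x_2,\dots\}$. A word is a finite sequence of letters; its support $\mathrm{supp}$ is the set of distinct letters occurring in it; a subword of $[a_1,\dots,a_m]$ is $[a_{i_1},\dots,a_{i_r}]$ with $i_1<\dots<i_r$. A substitution is a pair of words $\binom{\rho}{\sigma}$ over $\mathcal{X}$ with $\mathrm{supp}(\rho)=\mathrm{supp}(\sigma)$, considered up to renaming of letters by a bijection of supports applied simultaneously to $\rho$ and $\sigma$; the empty substitution is included. $dWHA$ is the free Abelian group on substitutions. The shuffle product $\times_{sh}$ of $[a_1,\dots,a_m]$ and $[b_1,\dots,b_n]$ is the sum with multiplicities of all interleavings preserving the order of the $a$'s and of the $b$'s. Multiplication: for $\binom{\rho}{\sigma},\binom{\rho'}{\sigma'}$ written with disjoint supports, the product is $\sum_\gamma\binom{\rho\rho'}{\gamma}$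 over the terms $\gamma$ of $\sigma\times_{sh}\sigma'$ ($\rho\rho'$ = concatenation). A cut $\sigma=\sigma_1\sigma_2$ is good if $\mathrm{supp}(\sigma_1)\cap\mathrm{supp}(\sigma_2)=\emptyset$. For $p=\binom{\rho}{\sigma}$ and a subword $\sigma_1$ of $\sigma$, $p^{ -1}(\sigma_1)$ is the subword of $\rho$ consisting of all letters of $\rho$ in $\mathrm{supp}(\sigma_1)$. Comultiplication: $\mu\binom{\rho}{\sigma}=\sum\binom{p^{ -1}(\sigma_1)}{\sigma_1}\otimes\binom{p^{ -1}(\sigma_2)}{\sigma_2}$ over all good cuts $\sigma=\sigma_1\sigma_2$. The unit is the empty substitution; the counit is $1$ on the empty substitution and $0$ on others. -}

module Defs where

open import Data.Nat using (ℕ; zero; suc; _+_; _*_; _≡ᵇ_)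
open import Data.Bool using (Bool; true; false; not; if_then_else_)
open import Data.List using (List; []; _∷_; _++_; map; concatMap; filterᵇ; splitAt; upTo; length)
open import Data.Bool.ListAction using (any; all)
open import Data.Nat.ListAction using (sum)
open import Data.List.Membership.Propositional using (_∈_)
open import Data.Product using (_×_; _,_; proj₁; proj₂; Σ)
open import Data.Empty using (⊥)
open import Relation.Nullary using (¬_)
open import Relation.Binary.PropositionalEquality using (_≡_)
open import Function.Bundles using (_⇔_)

-- Letters of the alphabet 𝒳 = {x₁, x₂, …} are encoded as natural numbers.
Word : Set
Word = List ℕ

-- A (representative of a) substitution (ρ over σ) is a pair of words (ρ , σ).
Subst : Set
Subst = Word × Word

IsSubst : Subst → Set
IsSubst (ρ , σ) = ∀ x → (x ∈ ρ) ⇔ (x ∈ σ)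

DisjointSupp : Subst → Subst → Set
DisjointSupp (ρ , _) (ρ' , _) = ∀ x → x ∈ ρ → x ∈ ρ' → ⊥

-- Elements of dWHA with nonnegative coefficients, as formal sums
-- (a list of substitutions, repetitions = multiplicities).
Elem : Set
Elem = List Subst

-- Elements of dWHA ⊗ dWHA, as formal sums of pure tensors a ⊗ b.
Elem⊗ : Set
Elem⊗ = List (Subst × Subst)

shuffle : Word → Word → List Word
shuffle [] ys = ys ∷ []
shuffle (x ∷ xs) [] = (x ∷ xs) ∷ []
shuffle (x ∷ xs) (y ∷ ys) =
  map (x ∷_) (shuffle xs (y ∷ ys)) ++ map (y ∷_) (shuffle (x ∷ xs) ys)

-- Multiplication m(p ⊗ p') for p, p' written with disjoint supports.
mult : Subst → Subst → Elem
mult (ρ , σ) (ρ' , σ') = map (λ γ → (ρ ++ ρ' , γ)) (shuffle σ σ')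

elemᵇ : ℕ → Word → Bool
elemᵇ x w = any (λ y → x ≡ᵇ y) w

goodᵇ : Word → Word → Bool
goodᵇ σ₁ σ₂ = all (λ x → not (elemᵇ x σ₂)) σ₁

preimage : Word → Word → Word
preimage ρ σ₁ = filterᵇ (λ x → elemᵇ x σ₁) ρ

comult : Subst → Elem⊗
comult (ρ , σ) = concatMap term (upTo (suc (length σ)))
  where
  term : ℕ → Elem⊗
  term k with splitAt k σ
  ... | (σ₁ , σ₂) =
    if goodᵇ σ₁ σ₂
    then ((preimage ρ σ₁ , σ₁) , (preimage ρ σ₂ , σ₂)) ∷ []
    else []

-- ⟨ (ρ over σ) , (ρ' over σ') ⟩ = 1 iff there is a renaming (a bijection of
-- supports, i.e. a map injective on supp ρ = supp σ) sending ρ to σ' and σ to ρ'.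
Dual : Subst → Subst → Set
Dual (ρ , σ) (ρ' , σ') =
  Σ (ℕ → ℕ) λ f →
    (∀ x y → x ∈ ρ → y ∈ ρ → f x ≡ f y → x ≡ y)
    × map f ρ ≡ σ' × map f σ ≡ ρ'

IsPairing : (Subst → Subst → ℕ) → Set
IsPairing pair =
  ∀ a b → (Dual a b → pair a b ≡ 1) × (¬ Dual a b → pair a b ≡ 0)

pairElem : (Subst → Subst → ℕ) → Elem → Subst → ℕ
pairElem pair xs q = sum (map (λ a → pair a q) xs)

pair⊗ : (Subst → Subst → ℕ) → Subst × Subst → Elem⊗ → ℕ
pair⊗ pair (a , b) ts = sum (map (λ t → pair a (proj₁ t) * pair b (proj₂ t)) ts)

-- Both sides are sums of pairing values, which lie in {0,1}, and each sum has at most one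
-- nonzero term: a renaming realising ⟨ρρ' over γ, q⟩ is fixed on ρρ' by the top row of q, so it
-- determines γ; and a dual of (ρ over σ) has a top row of length |ρ|, which fixes the cut. A renaming f with f(ρρ') = υ and f(γ) = τ cuts υ into
-- f(ρ) f(ρ'), a good cut because f is injective, and restricts to duals of p and p' because
-- restricting γ to supp ρ gives back σ. Conversely, renamings for the two halves υ₁ υ₂ of a good
-- cut have disjoint images and glue to one renaming f; τ interleaves its restrictions f(σ) and
-- f(σ') to supp υ₁ and supp υ₂, hence is f(γ) for a shuffle γ of σ and σ'.

{-# OPTIONS --safe #-}
module Submission where

open import Defs
open import Data.Nat using (ℕ; suc; _+_; _*_; _≤_; z≤n; s≤s; s≤s⁻¹; _≟_; _≤?_)
open import Data.Product using (_,_)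
open import Relation.Binary.PropositionalEquality using (_≡_)

open import Data.Nat.Properties
  using (≤-antisym; ≤-refl; ≤-trans; ≤-reflexive; m≤m+n; m≤n+m; *-mono-≤; +-identityʳ;
         m*n≡1⇒m≡1; m*n≡1⇒n≡1; n≤1⇒n≡0∨n≡1; 0≢1+n; ≡ᵇ⇒≡; ≡⇒≡ᵇ; m≤n⇒m⊓n≡m)
open import Data.Nat.ListAction using (sum)
open import Data.Nat.ListAction.Properties using (sum-++)
open import Data.Bool using (true; false; not; T; if_then_else_)
open import Data.Bool.Properties using (T-≡)
open import Data.List using (List; []; _∷_; _++_; map; filter; concatMap; splitAt; upTo; length)
open import Data.List.Properties
  using (map-++; map-∘; map-cong-local; length-map; length-++; length-take; splitAt-defn; take++drop≡id;
         filter-accept; filter-reject; filter-≐; ≡-dec; ∷-injectiveˡ; ∷-injectiveʳ)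
open import Data.List.Membership.Propositional using (_∈_; _∉_; find)
open import Data.List.Membership.Propositional.Properties
  using (∈-map⁺; ∈-map⁻; ∈-++⁺ˡ; ∈-++⁺ʳ; ∈-++⁻; ∈-upTo⁺; ∈-upTo⁻)
open import Data.List.Membership.DecPropositional _≟_ using (_∈?_)
open import Data.List.Relation.Unary.Any using (Any; here; there)
import Data.List.Relation.Unary.Any as Any
open import Data.List.Relation.Unary.Any.Properties using (any⁺; any⁻)
open import Data.List.Relation.Unary.All using (All; []; _∷_)
import Data.List.Relation.Unary.All as All
open import Data.List.Relation.Unary.All.Properties using (all⁺; all⁻)
open import Data.List.Relation.Unary.Unique.Propositional using (Unique; []; _∷_)
import Data.List.Relation.Unary.Unique.Propositional.Properties as Unique
open import Data.List.Relation.Binary.Disjoint.Propositional using (Disjoint; contractₗ; contractᵣ)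
open import Data.List.Relation.Binary.Subset.Propositional using (_⊆_)
open import Data.List.Relation.Binary.Subset.Propositional.Properties using (++⁺)
open import Data.List.Relation.Binary.Equality.Propositional using (≋-refl)
open import Data.List.Relation.Binary.Permutation.Propositional.Properties using (∈-resp-↭)
open import Data.List.Relation.Ternary.Interleaving.Propositional
  using (Interleaving; []; consˡ; consʳ; left; right; swap; toPermutation)
open import Data.List.Relation.Ternary.Interleaving.Propositional.Properties using (filter⁺)
open import Data.Product using (∃; ∃₂; _×_; proj₁; proj₂; uncurry)
import Data.Product as Σ
open import Data.Sum using (inj₁; inj₂; [_,_]′)
open import Data.Empty using (⊥-elim)
open import Function using (_∘_; id; _⇔_; mk⇔; Equivalence)
open import Relation.Nullary using (¬_; Dec; yes; no; does; ¬?; contradiction)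
open import Relation.Nullary.Decidable using (decidable-stable; T?)
open import Relation.Nullary.Negation using (¬¬-map)
open import Relation.Unary using (∁; Decidable)
open import Relation.Binary.PropositionalEquality
  using (refl; sym; trans; cong; cong₂; subst; subst₂; module ≡-Reasoning)

T-not : ∀ {b} → T (not b) ⇔ (¬ T b)
T-not {true}  = mk⇔ (λ ()) (λ ¬t → ¬t _)
T-not {false} = mk⇔ (λ _ ()) (λ _ → _)

elemᵇ⇔∈ : ∀ {x w} → T (elemᵇ x w) ⇔ x ∈ w
elemᵇ⇔∈ {x} {w} = mk⇔ (Any.map (≡ᵇ⇒≡ x _) ∘ any⁻ _ w) (any⁺ _ ∘ Any.map (≡⇒≡ᵇ x _))

goodᵇ⇔Disjoint : ∀ {a b} → T (goodᵇ a b) ⇔ Disjoint a b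
goodᵇ⇔Disjoint {a} {b} = mk⇔ to from
  where
  to : T (goodᵇ a b) → Disjoint a b
  to good (v∈a , v∈b) =
    Equivalence.to T-not (All.lookup (all⁺ _ a good) v∈a) (Equivalence.from elemᵇ⇔∈ v∈b)
  from : Disjoint a b → T (goodᵇ a b)
  from a#b = all⁻ _ (All.tabulate λ v∈a →
    Equivalence.from T-not λ v∈ᵇb → a#b (v∈a , Equivalence.to elemᵇ⇔∈ v∈ᵇb))

preimage≡filter : ∀ w s → preimage w s ≡ filter (_∈? s) w
preimage≡filter w s =
  filter-≐ (T? ∘ λ x → elemᵇ x s) (_∈? s) (Equivalence.to elemᵇ⇔∈ , Equivalence.from elemᵇ⇔∈) w

-- Filters, interleavings and shuffles

module _ {A : Set} where

  filter-cong-local : ∀ {P Q : A → Set} (P? : Decidable P) (Q? : Decidable Q) {xs} →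
                      All (λ x → P x ⇔ Q x) xs → filter P? xs ≡ filter Q? xs
  filter-cong-local P? Q? [] = refl
  filter-cong-local P? Q? {x ∷ xs} (Px⇔Qx ∷ P⇔Q) with P? x
  ... | yes Px = trans (cong (x ∷_) (filter-cong-local P? Q? P⇔Q))
                       (sym (filter-accept Q? (Equivalence.to Px⇔Qx Px)))
  ... | no ¬Px = trans (filter-cong-local P? Q? P⇔Q)
                       (sym (filter-reject Q? (¬Px ∘ Equivalence.from Px⇔Qx)))

  filter-interleaving : ∀ {P : A → Set} (P? : Decidable P) {l r xs} →
                        Interleaving l r xs → All P l → All (∁ P) r → filter P? xs ≡ l
  filter-interleaving P? [] [] [] = refl
  filter-interleaving P? (consˡ sp) (Px ∷ Pl) ¬Pr =
    trans (filter-accept P? Px) (cong (_ ∷_) (filter-interleaving P? sp Pl ¬Pr))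
  filter-interleaving P? (consʳ sp) Pl (¬Px ∷ ¬Pr) =
    trans (filter-reject P? ¬Px) (filter-interleaving P? sp Pl ¬Pr)

  interleaving-⊆ : ∀ {l r xs : List A} → Interleaving l r xs → xs ⊆ l ++ r
  interleaving-⊆ sp = ∈-resp-↭ (toPermutation sp)

  interleaving-map⁻ : ∀ {B : Set} (f : A → B) l r {ys} → Interleaving (map f l) (map f r) ys →
                      ∃ λ xs → Interleaving l r xs × map f xs ≡ ys
  interleaving-map⁻ f []      []      []         = [] , [] , refl
  interleaving-map⁻ f (x ∷ l) []      (consˡ sp) =
    Σ.map (x ∷_) (Σ.map consˡ (cong (f x ∷_))) (interleaving-map⁻ f l [] sp)
  interleaving-map⁻ f []      (y ∷ r) (consʳ sp) =
    Σ.map (y ∷_) (Σ.map consʳ (cong (f y ∷_))) (interleaving-map⁻ f [] r sp)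
  interleaving-map⁻ f (x ∷ l) (y ∷ r) (consˡ sp) =
    Σ.map (x ∷_) (Σ.map consˡ (cong (f x ∷_))) (interleaving-map⁻ f l (y ∷ r) sp)
  interleaving-map⁻ f (x ∷ l) (y ∷ r) (consʳ sp) =
    Σ.map (y ∷_) (Σ.map consʳ (cong (f y ∷_))) (interleaving-map⁻ f (x ∷ l) r sp)

shuffle-[]ʳ : ∀ a → shuffle a [] ≡ a ∷ []
shuffle-[]ʳ []      = refl
shuffle-[]ʳ (x ∷ a) = refl

shuffle-consˡ : ∀ x a b {γ} → γ ∈ shuffle a b → x ∷ γ ∈ shuffle (x ∷ a) b
shuffle-consˡ x a [] γ∈ with subst (_ ∈_) (shuffle-[]ʳ a) γ∈
... | here refl = here refl
shuffle-consˡ x a (y ∷ b) γ∈ = ∈-++⁺ˡ (∈-map⁺ (x ∷_) γ∈)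

shuffle-consʳ : ∀ y a b {γ} → γ ∈ shuffle a b → y ∷ γ ∈ shuffle a (y ∷ b)
shuffle-consʳ y []      b (here refl) = here refl
shuffle-consʳ y (x ∷ a) b γ∈          = ∈-++⁺ʳ _ (∈-map⁺ (y ∷_) γ∈)

shuffle⁺ : ∀ {a b γ} → Interleaving a b γ → γ ∈ shuffle a b
shuffle⁺                 []         = here refl
shuffle⁺ {x ∷ a} {b}     (consˡ sp) = shuffle-consˡ x a b (shuffle⁺ sp)
shuffle⁺ {a}     {y ∷ b} (consʳ sp) = shuffle-consʳ y a b (shuffle⁺ sp)

shuffle⁻ : ∀ a b {γ} → γ ∈ shuffle a b → Interleaving a b γ
shuffle⁻ []      b       (here refl) = right ≋-refl
shuffle⁻ (x ∷ a) []      (here refl) = left ≋-refl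
shuffle⁻ (x ∷ a) (y ∷ b) γ∈ with ∈-++⁻ (map (x ∷_) (shuffle a (y ∷ b))) γ∈
... | inj₁ γ∈ˡ with γ′ , γ′∈ , refl ← ∈-map⁻ (x ∷_) γ∈ˡ = consˡ (shuffle⁻ a (y ∷ b) γ′∈)
... | inj₂ γ∈ʳ with γ′ , γ′∈ , refl ← ∈-map⁻ (y ∷_) γ∈ʳ = consʳ (shuffle⁻ (x ∷ a) b γ′∈)

shuffle-unique : ∀ a b → Disjoint a b → Unique (shuffle a b)
shuffle-unique []      b       _   = [] ∷ []
shuffle-unique (x ∷ a) []      _   = [] ∷ []
shuffle-unique (x ∷ a) (y ∷ b) a#b =
  Unique.++⁺ (Unique.map⁺ ∷-injectiveʳ (shuffle-unique a (y ∷ b) (contractₗ a#b)))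
             (Unique.map⁺ ∷-injectiveʳ (shuffle-unique (x ∷ a) b (contractᵣ a#b)))
             heads-differ
  where
  heads-differ : Disjoint (map (x ∷_) (shuffle a (y ∷ b))) (map (y ∷_) (shuffle (x ∷ a) b))
  heads-differ (v∈ˡ , v∈ʳ) with ∈-map⁻ _ v∈ˡ | ∈-map⁻ _ v∈ʳ
  ... | _ , _ , refl | _ , _ , x∷γ≡y∷γ′ = a#b (here refl , here (∷-injectiveˡ x∷γ≡y∷γ′))

-- Sums and splits

module _ {A : Set} (g : A → ℕ) where

  ≤-sum-map : ∀ {x xs} → x ∈ xs → g x ≤ sum (map g xs)
  ≤-sum-map (here refl) = m≤m+n _ _
  ≤-sum-map (there x∈)  = ≤-trans (≤-sum-map x∈) (m≤n+m _ _)

  sum-map-≡0 : ∀ {xs} → All (λ x → g x ≡ 0) xs → sum (map g xs) ≡ 0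
  sum-map-≡0 []              = refl
  sum-map-≡0 (gx≡0 ∷ g≡0) rewrite gx≡0 = sum-map-≡0 g≡0

  sum-map-≤1 : ∀ {xs} → All (λ x → g x ≤ 1) xs → Unique xs →
               (∀ {x y} → x ∈ xs → y ∈ xs → g x ≡ 1 → g y ≡ 1 → x ≡ y) → sum (map g xs) ≤ 1
  sum-map-≤1 [] [] _ = z≤n
  sum-map-≤1 {x ∷ xs} (gx≤1 ∷ g≤1) (x∉xs ∷ unique) at-most-one with n≤1⇒n≡0∨n≡1 gx≤1
  ... | inj₁ gx≡0 rewrite gx≡0 = sum-map-≤1 g≤1 unique (λ y∈ z∈ → at-most-one (there y∈) (there z∈))
  ... | inj₂ gx≡1 =
    subst₂ (λ m n → m + n ≤ 1) (sym gx≡1) (sym (sum-map-≡0 (All.tabulate rest≡0))) ≤-refl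
    where
    rest≡0 : ∀ {y} → y ∈ xs → g y ≡ 0
    rest≡0 {y} y∈xs with n≤1⇒n≡0∨n≡1 (All.lookup g≤1 y∈xs)
    ... | inj₁ gy≡0 = gy≡0
    ... | inj₂ gy≡1 =
      contradiction (at-most-one (here refl) (there y∈xs) gx≡1 gy≡1) (All.lookup x∉xs y∈xs)

  sum-map-≡1⁻ : ∀ {xs} → All (λ x → g x ≤ 1) xs → sum (map g xs) ≡ 1 → Any (λ x → g x ≡ 1) xs
  sum-map-≡1⁻ {x ∷ xs} (gx≤1 ∷ g≤1) sum≡1 with n≤1⇒n≡0∨n≡1 gx≤1
  ... | inj₁ gx≡0 = there (sum-map-≡1⁻ g≤1 (subst (λ n → n + sum (map g xs) ≡ 1) gx≡0 sum≡1))
  ... | inj₂ gx≡1 = here gx≡1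

  sum-map-≡1⁺ : ∀ {x xs} → sum (map g xs) ≤ 1 → x ∈ xs → g x ≡ 1 → sum (map g xs) ≡ 1
  sum-map-≡1⁺ {xs = xs} sum≤1 x∈ gx≡1 = ≤-antisym sum≤1 (subst (_≤ sum (map g xs)) gx≡1 (≤-sum-map x∈))

  sum-map-concatMap : ∀ {B : Set} (t : B → List A) xs →
                      sum (map g (concatMap t xs)) ≡ sum (map (sum ∘ map g ∘ t) xs)
  sum-map-concatMap t []       = refl
  sum-map-concatMap t (x ∷ xs) = begin
    sum (map g (t x ++ concatMap t xs))               ≡⟨ cong sum (map-++ g (t x) _) ⟩
    sum (map g (t x) ++ map g (concatMap t xs))       ≡⟨ sum-++ (map g (t x)) _ ⟩
    sum (map g (t x)) + sum (map g (concatMap t xs))  ≡⟨ cong (_ +_) (sum-map-concatMap t xs) ⟩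
    sum (map g (t x)) + sum (map (sum ∘ map g ∘ t) xs) ∎
    where open ≡-Reasoning

≤1-ext : ∀ {m n} → m ≤ 1 → n ≤ 1 → (m ≡ 1 → n ≡ 1) → (n ≡ 1 → m ≡ 1) → m ≡ n
≤1-ext m≤1 n≤1 m≡1⇒n≡1 n≡1⇒m≡1 with n≤1⇒n≡0∨n≡1 m≤1 | n≤1⇒n≡0∨n≡1 n≤1
... | inj₁ refl | inj₁ refl = refl
... | inj₁ refl | inj₂ refl = n≡1⇒m≡1 refl
... | inj₂ refl | inj₁ refl = sym (m≡1⇒n≡1 refl)
... | inj₂ refl | inj₂ refl = refl

splitAt-++ : ∀ {A : Set} k (xs : List A) → proj₁ (splitAt k xs) ++ proj₂ (splitAt k xs) ≡ xs
splitAt-++ k xs = trans (cong (uncurry _++_) (splitAt-defn k xs)) (take++drop≡id k xs)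

splitAt-length : ∀ {A : Set} (xs ys : List A) → splitAt (length xs) (xs ++ ys) ≡ (xs , ys)
splitAt-length []       ys = refl
splitAt-length (x ∷ xs) ys rewrite splitAt-length xs ys = refl

length-splitAt : ∀ {A : Set} {k} (xs : List A) → k ≤ length xs → length (proj₁ (splitAt k xs)) ≡ k
length-splitAt {k = k} xs k≤ =
  trans (cong (length ∘ proj₁) (splitAt-defn k xs)) (trans (length-take k xs) (m≤n⇒m⊓n≡m k≤))

-- Renamings and duality

InjectiveOn : ∀ {A B : Set} → List A → (A → B) → Set
InjectiveOn S f = ∀ x y → x ∈ S → y ∈ S → f x ≡ f y → x ≡ y

module _ {A B : Set} {f : A → B} where

  injectiveOn-⊆ : ∀ {xs ys} → xs ⊆ ys → InjectiveOn ys f → InjectiveOn xs f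
  injectiveOn-⊆ xs⊆ys inj x y x∈ y∈ = inj x y (xs⊆ys x∈) (xs⊆ys y∈)

  injectiveOn-resp : ∀ {g : A → B} {xs} → (∀ {x} → x ∈ xs → f x ≡ g x) →
                     InjectiveOn xs f → InjectiveOn xs g
  injectiveOn-resp f≗g inj x y x∈ y∈ gx≡gy =
    inj x y x∈ y∈ (trans (f≗g x∈) (trans gx≡gy (sym (f≗g y∈))))

  injectiveOn-++ : ∀ {xs ys} → InjectiveOn xs f → InjectiveOn ys f →
                   Disjoint (map f xs) (map f ys) → InjectiveOn (xs ++ ys) f
  injectiveOn-++ {xs} {ys} injˡ injʳ fxs#fys x y x∈ y∈ fx≡fy with ∈-++⁻ xs x∈ | ∈-++⁻ xs y∈
  ... | inj₁ x∈xs | inj₁ y∈xs = injˡ x y x∈xs y∈xs fx≡fy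
  ... | inj₂ x∈ys | inj₂ y∈ys = injʳ x y x∈ys y∈ys fx≡fy
  ... | inj₁ x∈xs | inj₂ y∈ys =
    ⊥-elim (fxs#fys (∈-map⁺ f x∈xs , subst (_∈ map f ys) (sym fx≡fy) (∈-map⁺ f y∈ys)))
  ... | inj₂ x∈ys | inj₁ y∈xs =
    ⊥-elim (fxs#fys (∈-map⁺ f y∈xs , subst (_∈ map f ys) fx≡fy (∈-map⁺ f x∈ys)))

  map-disjoint : ∀ {xs ys} → InjectiveOn (xs ++ ys) f → Disjoint xs ys → Disjoint (map f xs) (map f ys)
  map-disjoint {xs} {ys} inj xs#ys (v∈ˡ , v∈ʳ) with ∈-map⁻ _ v∈ˡ | ∈-map⁻ _ v∈ʳ
  ... | x , x∈xs , refl | y , y∈ys , fx≡fy =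
    xs#ys (x∈xs , subst (_∈ ys) (sym (inj x y (∈-++⁺ˡ x∈xs) (∈-++⁺ʳ xs y∈ys) fx≡fy)) y∈ys)

  map-injectiveOn : ∀ {S xs ys} → InjectiveOn S f → xs ⊆ S → ys ⊆ S → map f xs ≡ map f ys → xs ≡ ys
  map-injectiveOn {xs = []}     {[]}     inj _ _ _ = refl
  map-injectiveOn {xs = x ∷ xs} {y ∷ ys} inj xs⊆S ys⊆S fxs≡fys =
    cong₂ _∷_ (inj x y (xs⊆S (here refl)) (ys⊆S (here refl)) (∷-injectiveˡ fxs≡fys))
              (map-injectiveOn inj (xs⊆S ∘ there) (ys⊆S ∘ there) (∷-injectiveʳ fxs≡fys))

  map-≡⇒≗-on : ∀ {g : A → B} {xs x} → map f xs ≡ map g xs → x ∈ xs → f x ≡ g x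
  map-≡⇒≗-on {xs = _ ∷ _} fxs≡gxs (here refl) = ∷-injectiveˡ fxs≡gxs
  map-≡⇒≗-on {xs = _ ∷ _} fxs≡gxs (there x∈) = map-≡⇒≗-on (∷-injectiveʳ fxs≡gxs) x∈

glue : Word → (ℕ → ℕ) → (ℕ → ℕ) → ℕ → ℕ
glue ρ f₁ f₂ x = if does (x ∈? ρ) then f₁ x else f₂ x

module _ {ρ : Word} {f₁ f₂ : ℕ → ℕ} where

  glue-∈ : ∀ {x} → x ∈ ρ → glue ρ f₁ f₂ x ≡ f₁ x
  glue-∈ {x} x∈ρ with x ∈? ρ
  ... | yes _   = refl
  ... | no x∉ρ = contradiction x∈ρ x∉ρ

  glue-∉ : ∀ {x} → x ∉ ρ → glue ρ f₁ f₂ x ≡ f₂ x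
  glue-∉ {x} x∉ρ with x ∈? ρ
  ... | yes x∈ρ = contradiction x∈ρ x∉ρ
  ... | no _    = refl

module _ {S : Word} {f : ℕ → ℕ} (inj : InjectiveOn S f) {s : Word} (s⊆S : s ⊆ S) where

  filter-∈-map : ∀ {w} → w ⊆ S → filter (_∈? map f s) (map f w) ≡ map f (filter (_∈? s) w)
  filter-∈-map {[]}    _    = refl
  filter-∈-map {x ∷ w} w⊆S with x ∈? s
  ... | yes x∈s = trans (filter-accept (_∈? map f s) (∈-map⁺ f x∈s))
                        (cong (f x ∷_) (filter-∈-map (w⊆S ∘ there)))
  ... | no x∉s  = trans (filter-reject (_∈? map f s) fx∉fs) (filter-∈-map (w⊆S ∘ there))
    where
    fx∉fs : f x ∉ map f s
    fx∉fs fx∈fs with y , y∈s , fx≡fy ← ∈-map⁻ f fx∈fs =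
      x∉s (subst (_∈ s) (sym (inj x y (w⊆S (here refl)) (s⊆S y∈s) fx≡fy)) y∈s)

  preimage-map : ∀ {w} → w ⊆ S → preimage (map f w) (map f s) ≡ map f (preimage w s)
  preimage-map {w} w⊆S =
    trans (preimage≡filter (map f w) (map f s))
          (trans (filter-∈-map w⊆S) (cong (map f) (sym (preimage≡filter w s))))

  dual-restrict : ∀ {γ} → γ ⊆ S → Dual (s , preimage γ s) (preimage (map f γ) (map f s) , map f s)
  dual-restrict γ⊆S = f , injectiveOn-⊆ s⊆S inj , refl , sym (preimage-map γ⊆S)

preimage-interleaving : ∀ {ρ σ σ′ γ} → Interleaving σ σ′ γ → σ ⊆ ρ → Disjoint ρ σ′ → preimage γ ρ ≡ σ
preimage-interleaving {ρ} {γ = γ} sp σ⊆ρ ρ#σ′ =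
  trans (preimage≡filter γ ρ)
        (filter-interleaving (_∈? ρ) sp (All.tabulate σ⊆ρ)
                             (All.tabulate λ x∈σ′ x∈ρ → ρ#σ′ (x∈ρ , x∈σ′)))

interleaving-preimage : ∀ {τ υ₁ υ₂} → Disjoint υ₁ υ₂ → τ ⊆ υ₁ ++ υ₂ →
                        Interleaving (preimage τ υ₁) (preimage τ υ₂) τ
interleaving-preimage {τ} {υ₁} {υ₂} υ₁#υ₂ τ⊆υ =
  subst₂ (λ l r → Interleaving l r τ)
         (sym (preimage≡filter τ υ₁)) (sym (trans (preimage≡filter τ υ₂) complement))
         (filter⁺ (_∈? υ₁) τ)
  where
  complement : filter (_∈? υ₂) τ ≡ filter (¬? ∘ (_∈? υ₁)) τ
  complement = filter-cong-local (_∈? υ₂) (¬? ∘ (_∈? υ₁)) (All.tabulate λ x∈τ →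
    mk⇔ (λ x∈υ₂ x∈υ₁ → υ₁#υ₂ (x∈υ₁ , x∈υ₂))
        (λ x∉υ₁ → [ (λ x∈υ₁ → contradiction x∈υ₁ x∉υ₁) , id ]′ (∈-++⁻ υ₁ (τ⊆υ x∈τ))))

dual-length : ∀ {ρ σ τ υ} → Dual (ρ , σ) (τ , υ) → length υ ≡ length ρ
dual-length {ρ} (f , _ , fρ≡υ , _) = trans (cong length (sym fρ≡υ)) (length-map f ρ)

dual-injective : ∀ {ρ γ₁ γ₂ q} → γ₁ ⊆ ρ → γ₂ ⊆ ρ → Dual (ρ , γ₁) q → Dual (ρ , γ₂) q → γ₁ ≡ γ₂
dual-injective {ρ} {γ₁} {γ₂} {τ , υ} γ₁⊆ρ γ₂⊆ρ (f₁ , f₁-inj , f₁ρ≡υ , f₁γ₁≡τ)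
                                                (f₂ , _ , f₂ρ≡υ , f₂γ₂≡τ) =
  map-injectiveOn f₁-inj γ₁⊆ρ γ₂⊆ρ (begin
    map f₁ γ₁ ≡⟨ f₁γ₁≡τ ⟩
    τ         ≡⟨ sym f₂γ₂≡τ ⟩
    map f₂ γ₂ ≡⟨ map-cong-local (All.tabulate λ x∈γ₂ → sym (map-≡⇒≗-on f₁ρ≡f₂ρ (γ₂⊆ρ x∈γ₂))) ⟩
    map f₁ γ₂ ∎)
  where
  open ≡-Reasoning
  f₁ρ≡f₂ρ : map f₁ ρ ≡ map f₂ ρ
  f₁ρ≡f₂ρ = trans f₁ρ≡υ (sym f₂ρ≡υ)

module _ {ρ σ ρ′ σ′ : Word} (p : IsSubst (ρ , σ)) (p′ : IsSubst (ρ′ , σ′)) (ρ#ρ′ : Disjoint ρ ρ′) where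

  private
    σ⊆ρ : σ ⊆ ρ
    σ⊆ρ = Equivalence.from (p _)

    σ′⊆ρ′ : σ′ ⊆ ρ′
    σ′⊆ρ′ = Equivalence.from (p′ _)

  shuffle-⊆ : ∀ {γ} → Interleaving σ σ′ γ → γ ⊆ ρ ++ ρ′
  shuffle-⊆ sp x∈γ = ++⁺ σ⊆ρ σ′⊆ρ′ (interleaving-⊆ sp x∈γ)

  shuffle-disjoint : Disjoint σ σ′
  shuffle-disjoint (x∈σ , x∈σ′) = ρ#ρ′ (σ⊆ρ x∈σ , σ′⊆ρ′ x∈σ′)

  dual-product⇒dual-cut : ∀ {γ τ υ} → Interleaving σ σ′ γ → Dual (ρ ++ ρ′ , γ) (τ , υ) →
    ∃₂ λ υ₁ υ₂ → υ₁ ++ υ₂ ≡ υ × Disjoint υ₁ υ₂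
               × Dual (ρ , σ) (preimage τ υ₁ , υ₁) × Dual (ρ′ , σ′) (preimage τ υ₂ , υ₂)
  dual-product⇒dual-cut sp (f , inj , refl , refl) =
    map f ρ , map f ρ′ , sym (map-++ f ρ ρ′) , map-disjoint inj ρ#ρ′ ,
    subst (λ s → Dual (ρ , s) _) (preimage-interleaving sp σ⊆ρ ρ#σ′)
          (dual-restrict inj ∈-++⁺ˡ (shuffle-⊆ sp)) ,
    subst (λ s → Dual (ρ′ , s) _) (preimage-interleaving (swap sp) σ′⊆ρ′ ρ′#σ)
          (dual-restrict inj (∈-++⁺ʳ ρ) (shuffle-⊆ sp))
    where
    ρ#σ′ : Disjoint ρ σ′
    ρ#σ′ (x∈ρ , x∈σ′) = ρ#ρ′ (x∈ρ , σ′⊆ρ′ x∈σ′)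
    ρ′#σ : Disjoint ρ′ σ
    ρ′#σ (x∈ρ′ , x∈σ) = ρ#ρ′ (σ⊆ρ x∈σ , x∈ρ′)

  dual-cut⇒dual-product : ∀ {τ υ υ₁ υ₂} → IsSubst (τ , υ) → υ₁ ++ υ₂ ≡ υ → Disjoint υ₁ υ₂ →
    Dual (ρ , σ) (preimage τ υ₁ , υ₁) → Dual (ρ′ , σ′) (preimage τ υ₂ , υ₂) →
    ∃ λ γ → Interleaving σ σ′ γ × Dual (ρ ++ ρ′ , γ) (τ , υ)
  dual-cut⇒dual-product {τ} {υ₁ = υ₁} {υ₂} q refl υ₁#υ₂ (f₁ , f₁-inj , f₁ρ , f₁σ)
                                                         (f₂ , f₂-inj , f₂ρ′ , f₂σ′) =
    let γ , sp , fγ≡τ = interleaving-map⁻ f σ σ′ τ-interleaving in γ , sp , f , inj , fρρ′ , fγ≡τ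
    where
    f : ℕ → ℕ
    f = glue ρ f₁ f₂
    f≗f₁ : ∀ {x} → x ∈ ρ → f x ≡ f₁ x
    f≗f₁ = glue-∈ {f₁ = f₁} {f₂}
    f≗f₂ : ∀ {x} → x ∈ ρ′ → f x ≡ f₂ x
    f≗f₂ x∈ρ′ = glue-∉ {f₁ = f₁} {f₂} λ x∈ρ → ρ#ρ′ (x∈ρ , x∈ρ′)
    fρ : map f ρ ≡ υ₁
    fρ = trans (map-cong-local (All.tabulate f≗f₁)) f₁ρ
    fρ′ : map f ρ′ ≡ υ₂
    fρ′ = trans (map-cong-local (All.tabulate f≗f₂)) f₂ρ′
    fρρ′ : map f (ρ ++ ρ′) ≡ υ₁ ++ υ₂
    fρρ′ = trans (map-++ f ρ ρ′) (cong₂ _++_ fρ fρ′)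
    inj : InjectiveOn (ρ ++ ρ′) f
    inj = injectiveOn-++ (injectiveOn-resp (sym ∘ f≗f₁) f₁-inj)
                         (injectiveOn-resp (sym ∘ f≗f₂) f₂-inj)
                         (subst₂ Disjoint (sym fρ) (sym fρ′) υ₁#υ₂)
    τ-interleaving : Interleaving (map f σ) (map f σ′) τ
    τ-interleaving =
      subst₂ (λ l r → Interleaving l r τ)
             (sym (trans (map-cong-local (All.tabulate (f≗f₁ ∘ σ⊆ρ))) f₁σ))
             (sym (trans (map-cong-local (All.tabulate (f≗f₂ ∘ σ′⊆ρ′))) f₂σ′))
             (interleaving-preimage υ₁#υ₂ (Equivalence.to (q _)))

-- The pairing

-- Dual quantifies over all maps ℕ → ℕ and is not decided here: a pairing value 1 only yields
-- ¬ ¬ Dual, which suffices because every goal it is used for is decidable.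
dec-¬¬-elim : ∀ {A B : Set} → Dec B → ¬ ¬ A → (A → B) → B
dec-¬¬-elim B? ¬¬a a⇒b = decidable-stable B? (¬¬-map a⇒b ¬¬a)

module Pairing (pair : Subst → Subst → ℕ) (isPairing : IsPairing pair) where

  Dual⇒pair≡1 : ∀ {a b} → Dual a b → pair a b ≡ 1
  Dual⇒pair≡1 {a} {b} = proj₁ (isPairing a b)

  pair≡1⇒¬¬Dual : ∀ {a b} → pair a b ≡ 1 → ¬ ¬ Dual a b
  pair≡1⇒¬¬Dual {a} {b} pair≡1 ¬dual = 0≢1+n (trans (sym (proj₂ (isPairing a b) ¬dual)) pair≡1)

  pair≤1 : ∀ a b → pair a b ≤ 1
  pair≤1 a b = decidable-stable (pair a b ≤? 1) λ pair≰1 →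
    let ¬dual : ¬ Dual a b
        ¬dual dual = pair≰1 (≤-reflexive (Dual⇒pair≡1 dual))
    in pair≰1 (≤-trans (≤-reflexive (proj₂ (isPairing a b) ¬dual)) z≤n)

module SelfDuality (pair : Subst → Subst → ℕ) (isPairing : IsPairing pair)
  {ρ σ ρ′ σ′ τ υ : Word} (p : IsSubst (ρ , σ)) (p′ : IsSubst (ρ′ , σ′)) (q : IsSubst (τ , υ))
  (ρ#ρ′ : Disjoint ρ ρ′) where

  open Pairing pair isPairing

  shuffleValue : Word → ℕ
  shuffleValue γ = pair (ρ ++ ρ′ , γ) (τ , υ)

  tensorValue : Subst × Subst → ℕ
  tensorValue (a , b) = pair (ρ , σ) a * pair (ρ′ , σ′) b

  cut : ℕ → Word × Word
  cut k = splitAt k υ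

  -- cutTerms (cut k) is, definitionally, the summand of comult (τ , υ) at cut position k.
  cutTerms : Word × Word → Elem⊗
  cutTerms (υ₁ , υ₂) =
    if goodᵇ υ₁ υ₂ then ((preimage τ υ₁ , υ₁) , (preimage τ υ₂ , υ₂)) ∷ [] else []

  cutValue : Word × Word → ℕ
  cutValue c = sum (map tensorValue (cutTerms c))

  shuffleSum : ℕ
  shuffleSum = sum (map shuffleValue (shuffle σ σ′))

  cutSum : ℕ
  cutSum = sum (map (cutValue ∘ cut) (upTo (suc (length υ))))

  cutValue≤1 : ∀ c → cutValue c ≤ 1
  cutValue≤1 (υ₁ , υ₂) with goodᵇ υ₁ υ₂
  ... | false = z≤n
  ... | true  = subst (_≤ 1) (sym (+-identityʳ _)) (*-mono-≤ (pair≤1 _ _) (pair≤1 _ _))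

  cutValues≤1 : ∀ {ks} → All (λ k → cutValue (cut k) ≤ 1) ks
  cutValues≤1 = All.tabulate λ {k} _ → cutValue≤1 (cut k)

  shuffleValues≤1 : ∀ {γs} → All (λ γ → shuffleValue γ ≤ 1) γs
  shuffleValues≤1 = All.tabulate λ _ → pair≤1 _ _

  cutValue≡1⁻ : ∀ υ₁ υ₂ → cutValue (υ₁ , υ₂) ≡ 1 →
    Disjoint υ₁ υ₂ × pair (ρ , σ) (preimage τ υ₁ , υ₁) ≡ 1 × pair (ρ′ , σ′) (preimage τ υ₂ , υ₂) ≡ 1
  cutValue≡1⁻ υ₁ υ₂ value≡1 with goodᵇ υ₁ υ₂ in good
  ... | true = Equivalence.to goodᵇ⇔Disjoint (Equivalence.from T-≡ good) ,
               m*n≡1⇒m≡1 _ _ product≡1 , m*n≡1⇒n≡1 (pair (ρ , σ) (preimage τ υ₁ , υ₁)) _ product≡1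
    where
    product≡1 : pair (ρ , σ) (preimage τ υ₁ , υ₁) * pair (ρ′ , σ′) (preimage τ υ₂ , υ₂) ≡ 1
    product≡1 = trans (sym (+-identityʳ _)) value≡1

  cutValue≡1⁺ : ∀ {υ₁ υ₂} → Disjoint υ₁ υ₂ →
    pair (ρ , σ) (preimage τ υ₁ , υ₁) ≡ 1 → pair (ρ′ , σ′) (preimage τ υ₂ , υ₂) ≡ 1 →
    cutValue (υ₁ , υ₂) ≡ 1
  cutValue≡1⁺ υ₁#υ₂ pair₁≡1 pair₂≡1
    rewrite Equivalence.to T-≡ (Equivalence.from goodᵇ⇔Disjoint υ₁#υ₂) | pair₁≡1 | pair₂≡1 = refl

  cut-position : ∀ {k} → k ∈ upTo (suc (length υ)) → cutValue (cut k) ≡ 1 → k ≡ length ρ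
  cut-position {k} k∈ value≡1 =
    let _ , pair₁≡1 , _ = cutValue≡1⁻ (proj₁ (cut k)) (proj₂ (cut k)) value≡1 in
    dec-¬¬-elim (k ≟ length ρ) (pair≡1⇒¬¬Dual pair₁≡1) λ dual →
      trans (sym (length-splitAt υ (s≤s⁻¹ (∈-upTo⁻ k∈)))) (dual-length dual)

  cutSum≤1 : cutSum ≤ 1
  cutSum≤1 = sum-map-≤1 (cutValue ∘ cut) cutValues≤1 (Unique.upTo⁺ (suc (length υ)))
    λ k₁∈ k₂∈ value₁≡1 value₂≡1 → trans (cut-position k₁∈ value₁≡1) (sym (cut-position k₂∈ value₂≡1))

  shuffleSum≤1 : shuffleSum ≤ 1
  shuffleSum≤1 = sum-map-≤1 shuffleValue shuffleValues≤1
                            (shuffle-unique σ σ′ (shuffle-disjoint p p′ ρ#ρ′)) one-shuffle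
    where
    one-shuffle : ∀ {γ₁ γ₂} → γ₁ ∈ shuffle σ σ′ → γ₂ ∈ shuffle σ σ′ →
                  shuffleValue γ₁ ≡ 1 → shuffleValue γ₂ ≡ 1 → γ₁ ≡ γ₂
    one-shuffle {γ₁} {γ₂} γ₁∈ γ₂∈ value₁≡1 value₂≡1 =
      dec-¬¬-elim (≡-dec _≟_ γ₁ γ₂) (pair≡1⇒¬¬Dual value₁≡1) λ dual₁ →
      dec-¬¬-elim (≡-dec _≟_ γ₁ γ₂) (pair≡1⇒¬¬Dual value₂≡1) λ dual₂ →
      dual-injective (shuffle-⊆ p p′ ρ#ρ′ (shuffle⁻ σ σ′ γ₁∈))
                     (shuffle-⊆ p p′ ρ#ρ′ (shuffle⁻ σ σ′ γ₂∈)) dual₁ dual₂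

  cutValue≡1⇒cutSum≡1 : ∀ {υ₁ υ₂} → υ₁ ++ υ₂ ≡ υ → cutValue (υ₁ , υ₂) ≡ 1 → cutSum ≡ 1
  cutValue≡1⇒cutSum≡1 {υ₁} {υ₂} υ₁υ₂≡υ value≡1 =
    sum-map-≡1⁺ (cutValue ∘ cut) cutSum≤1 (∈-upTo⁺ (s≤s |υ₁|≤|υ|))
                (subst (λ c → cutValue c ≡ 1) (sym cut≡υ₁,υ₂) value≡1)
    where
    cut≡υ₁,υ₂ : cut (length υ₁) ≡ (υ₁ , υ₂)
    cut≡υ₁,υ₂ = trans (cong (splitAt (length υ₁)) (sym υ₁υ₂≡υ)) (splitAt-length υ₁ υ₂)
    |υ₁|≤|υ| : length υ₁ ≤ length υ
    |υ₁|≤|υ| = subst (λ w → length υ₁ ≤ length w) υ₁υ₂≡υ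
                     (≤-trans (m≤m+n _ _) (≤-reflexive (sym (length-++ υ₁))))

  shuffleSum≡1⇒cutSum≡1 : shuffleSum ≡ 1 → cutSum ≡ 1
  shuffleSum≡1⇒cutSum≡1 sum≡1
    with γ , γ∈ , value≡1 ← find (sum-map-≡1⁻ shuffleValue shuffleValues≤1 sum≡1) =
    dec-¬¬-elim (cutSum ≟ 1) (pair≡1⇒¬¬Dual value≡1) λ dual →
    let υ₁ , υ₂ , υ₁υ₂≡υ , υ₁#υ₂ , dual₁ , dual₂ =
          dual-product⇒dual-cut p p′ ρ#ρ′ (shuffle⁻ σ σ′ γ∈) dual
    in cutValue≡1⇒cutSum≡1 {υ₁} {υ₂} υ₁υ₂≡υ
         (cutValue≡1⁺ {υ₁} {υ₂} υ₁#υ₂ (Dual⇒pair≡1 dual₁) (Dual⇒pair≡1 dual₂))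

  cutSum≡1⇒shuffleSum≡1 : cutSum ≡ 1 → shuffleSum ≡ 1
  cutSum≡1⇒shuffleSum≡1 sum≡1
    with k , _ , value≡1 ← find (sum-map-≡1⁻ (cutValue ∘ cut) {upTo (suc (length υ))} cutValues≤1 sum≡1)
    with υ₁#υ₂ , pair₁≡1 , pair₂≡1 ← cutValue≡1⁻ (proj₁ (cut k)) (proj₂ (cut k)) value≡1 =
    dec-¬¬-elim (shuffleSum ≟ 1) (pair≡1⇒¬¬Dual pair₁≡1) λ dual₁ →
    dec-¬¬-elim (shuffleSum ≟ 1) (pair≡1⇒¬¬Dual pair₂≡1) λ dual₂ →
    let γ , sp , dual = dual-cut⇒dual-product p p′ ρ#ρ′ q (splitAt-++ k υ) υ₁#υ₂ dual₁ dual₂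
    in sum-map-≡1⁺ shuffleValue shuffleSum≤1 (shuffle⁺ sp) (Dual⇒pair≡1 dual)

theorem6p10 : (pair : Subst → Subst → ℕ) → IsPairing pair →
    (p p' q : Subst) → IsSubst p → IsSubst p' → IsSubst q → DisjointSupp p p' →
    pairElem pair (mult p p') q ≡ pair⊗ pair (p , p') (comult q)
theorem6p10 pair isPairing (ρ , σ) (ρ′ , σ′) (τ , υ) p p′ q p#p′ = begin
  pairElem pair (mult (ρ , σ) (ρ′ , σ′)) (τ , υ)
    ≡⟨ cong sum (sym (map-∘ (shuffle σ σ′))) ⟩
  shuffleSum
    ≡⟨ ≤1-ext shuffleSum≤1 cutSum≤1 shuffleSum≡1⇒cutSum≡1 cutSum≡1⇒shuffleSum≡1 ⟩
  cutSum
    ≡⟨ sym (sum-map-concatMap tensorValue (cutTerms ∘ cut) (upTo (suc (length υ)))) ⟩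
  pair⊗ pair ((ρ , σ) , (ρ′ , σ′)) (comult (τ , υ))
    ∎
  where
  open ≡-Reasoning
  open SelfDuality pair isPairing p p′ q (λ (x∈ρ , x∈ρ′) → p#p′ _ x∈ρ x∈ρ′)
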